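{- Let $\mathbf{A}=(A;\leq,{}',0,1)$ be a De Morgan poset and $G,H$ partial mappings of $A$ into itself which are semi-tense operators on $\mathbf A$ (see context), and suppose $R_G=(R_H)^{ -1}$, where $$R_K=\{(s,t)\in T_{\mathbf A}^{\mathrm{DMP}}\times T_{\mathbf A}^{\mathrm{DMP}}\mid \forall x\in\mathrm{dom}(K):\ s(K(x))\leq t(x)\}\quad (K\in\{G,H\}).$$ Then $(T_{\mathbf A}^{\mathrm{DMP}},R_G)$ is a frame with both $R_G$ and $(R_G)^{ -1}$ serial. Let $\widehat G,\widehat H$ be the operators on $M_2^{T_{\mathbf A}^{\mathrm{DMP}}}$ given by $\widehat G(p)(s)=\bigwedge_{M_2}\{p(t)\mid s\mathrel{R_G}t\}$ and $\widehat H(p)(s)=\bigwedge_{M_2}\{p(t)\mid t\mathrel{R_G}s\}$ (so that $(\mathbf{M}_2^{T_{\mathbf A}^{\mathrm{DMP}}};\widehat G,\widehat H)$ is a dynamic De Morgan algebra). Then the map $i_{\mathbf A}\colon A\to M_2^{T_{\mathbf A}^{\mathrm{DMP}}}$, $i_{\mathbf A}(a)(s)=s(a)$, is an order-reflecting morphism of De Morgan posets into the complete De Morgan lattice $\mathbf{M}_2^{T_{\mathbf A}^{\mathrm{DMP}}}$ such that $i_{\mathbf A}(G(a))=\widehat G(i_{\mathbf A}(a))$ for all $a\in\mathrm{dom}(G)$ and $i_{\mathbf A}(H(a))=\widehat H(i_{\mathbf A}(a))$ for all $a\in\mathrm{dom}(H)$.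
   Context: A De Morgan poset is a structure $(A;\leq,{}',0,1)$ where $(A;\leq)$ is a poset with least element $0$ and greatest element $1$, and $'$ is a unary operation with $a\leq b\Rightarrow b'\leq a'$ and $a''=a$. A morphism of De Morgan posets preserves order, negation, $0$, $1$; it is order reflecting if $f(a)\leq f(b)$ iff $a\leq b$. For a partial map $K$ on $A$, its dual $K^{\partial}$ is defined at $a$ iff $a'\in\mathrm{dom}(K)$, by $K^{\partial}(a)=K(a')'$; write $F=G^{\partial}$, $P=H^{\partial}$. Partial maps $G,H$ on $A$ are semi-tense operators if: (P1) $G(0)=0$, $G(1)=1$, $H(0)=0$, $H(1)=1$; (P2) $x\leq y$ implies $G(x)\leq G(y)$ whenever both exist, and $H(x)\leq H(y)$ whenever both exist; (P4) $x\leq y$ implies $G(x)\leq F(y)$ whenever $G(y')$ and $G(x)$ exist, and $H(x)\leq P(y)$ whenever $H(y')$ and $H(x)$ exist. A dynamic De Morgan algebra is a De Morgan poset with total maps $G,H$ satisfying (P1), (P2), (P4) and (P3): $x\leq G(P(x))$ and $x\leq H(F(x))$. A frame is a pair $(T,R)$ with $T$ non-empty and $R\subseteq T\times T$; $R$ is serial if every $x$ has some $y$ with $x\mathrel{R}y$. $\mathbf{M}_2$ is the four-element complete De Morgan lattice on $\{0,1\}\times\{0,1\}$ with componentwise order and $(a,b)'=(1-b,1-a)$; $\mathbf{M}_2^T$ is the direct power with componentwise order and negation. For a proper down-set $D$ of $\mathbf A$ (down-set with $0\in D$, $1\notin D$) let $h_D(a)=0$ iff $a\in D$ (else $1$), $h_D^{\partial}(a)=1-h_D(a')$,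 and $\kappa_D(a)=(h_D(a),h_D^{\partial}(a))\in M_2$. $T_{\mathbf A}^{\mathrm{DMP}}$ is the set of all $\kappa_D$, $D$ ranging over proper down-sets of $\mathbf A$. -}

module Defs where

open import Level using (0ℓ)
open import Function using (flip)
open import Data.Bool using (Bool; true; false; not) renaming (_≤_ to _≤ᵇ_)
open import Data.Product using (Σ; ∃; _×_; _,_; proj₁; proj₂)
open import Data.Maybe using (Maybe; just; nothing; map)
open import Relation.Binary.PropositionalEquality using (_≡_)
open import Relation.Binary.Structures using (IsPartialOrder)
open import Relation.Nullary using (does)
open import Axiom.ExcludedMiddle using (ExcludedMiddle)

record DeMorganPoset : Set₁ where
  infix 4 _≤_
  field
    Carrier        : Set
    _≤_            : Carrier → Carrier → Set
    isPartialOrder : IsPartialOrder _≡_ _≤_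
    _′             : Carrier → Carrier
    𝟘 𝟙            : Carrier
    𝟘-least        : ∀ x → 𝟘 ≤ x
    𝟙-greatest     : ∀ x → x ≤ 𝟙
    ′-antitone     : ∀ {a b} → a ≤ b → b ′ ≤ a ′
    ′-involutive   : ∀ a → (a ′) ′ ≡ a

module _ (𝔸 : DeMorganPoset) where
  open DeMorganPoset 𝔸

  PMap : Set
  PMap = Carrier → Maybe Carrier

  dual : PMap → PMap
  dual K a = map _′ (K (a ′))

  record SemiTense (G H : PMap) : Set where
    field
      G𝟘 : G 𝟘 ≡ just 𝟘
      G𝟙 : G 𝟙 ≡ just 𝟙
      H𝟘 : H 𝟘 ≡ just 𝟘
      H𝟙 : H 𝟙 ≡ just 𝟙
      G-mono : ∀ {x y gx gy} → x ≤ y → G x ≡ just gx → G y ≡ just gy → gx ≤ gy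
      H-mono : ∀ {x y hx hy} → x ≤ y → H x ≡ just hx → H y ≡ just hy → hx ≤ hy
      -- G(x) ≤ F(y) = G(y′)′
      GF : ∀ {x y gx gy′} → x ≤ y → G (y ′) ≡ just gy′ → G x ≡ just gx →
           gx ≤ gy′ ′
      -- H(x) ≤ P(y) = H(y′)′
      HP : ∀ {x y hx hy′} → x ≤ y → H (y ′) ≡ just hy′ → H x ≡ just hx →
           hx ≤ hy′ ′

M₂ : Set
M₂ = Bool × Bool

infix 4 _≤M_
_≤M_ : M₂ → M₂ → Set
(a , b) ≤M (c , d) = (a ≤ᵇ c) × (b ≤ᵇ d)

negM : M₂ → M₂
negM (a , b) = (not b , not a)

0M 1M : M₂
0M = (false , false)
1M = (true , true)

⋀M : ExcludedMiddle 0ℓ → {I : Set} → (I → Set) → (I → M₂) → M₂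
⋀M lem {I} S p =
  ( does (lem {∀ t → S t → proj₁ (p t) ≡ true})
  , does (lem {∀ t → S t → proj₂ (p t) ≡ true}) )

module _ (𝔸 : DeMorganPoset) where
  open DeMorganPoset 𝔸

  record ProperDownSet : Set where
    field
      member     : Carrier → Bool
      downClosed : ∀ {a b} → a ≤ b → member b ≡ true → member a ≡ true
      has𝟘       : member 𝟘 ≡ true
      no𝟙        : member 𝟙 ≡ false
  open ProperDownSet

  h : ProperDownSet → Carrier → Bool
  h D a = not (member D a)

  h∂ : ProperDownSet → Carrier → Bool
  h∂ D a = not (h D (a ′))

  κ : ProperDownSet → Carrier → M₂
  κ D a = (h D a , h∂ D a)

  -- T_A^DMP, indexed by proper down-sets (s ∈ T is κ s)
  T : Set
  T = ProperDownSet

  Rel : PMap 𝔸 → T → T → Set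
  Rel K s t = ∀ x y → K x ≡ just y → κ s y ≤M κ t x

  Serial : (T → T → Set) → Set
  Serial R = ∀ s → ∃ λ t → R s t

  iA : Carrier → T → M₂
  iA a s = κ s a

  Ĝ : ExcludedMiddle 0ℓ → (T → T → Set) → (T → M₂) → T → M₂
  Ĝ lem R p s = ⋀M lem (λ t → R s t) p

  Ĥ : ExcludedMiddle 0ℓ → (T → T → Set) → (T → M₂) → T → M₂
  Ĥ lem R p s = ⋀M lem (λ t → R t s) p

  IsDMPMorphism : (Carrier → T → M₂) → Set
  IsDMPMorphism f =
    (∀ a b → a ≤ b → ∀ s → f a s ≤M f b s) ×
    (∀ a s → f (a ′) s ≡ negM (f a s)) ×
    (∀ s → f 𝟘 s ≡ 0M) ×
    (∀ s → f 𝟙 s ≡ 1M)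

  IsOrderReflecting : (Carrier → T → M₂) → Set
  IsOrderReflecting f = ∀ a b → (∀ s → f a s ≤M f b s) → a ≤ b

{-# OPTIONS --safe #-}
-- With excluded middle, for every nonempty set V of elements none of which lies below 𝟘,
-- the elements lying above no element of V form a proper down-set. Taking V = {a} separates
-- a from every b with a ≰ b, which gives order reflection. For s ∈ T, the elements whose
-- K-image lies outside s generate in this way an R_K-successor of s; this is where (P4) is
-- used. Since s R_K t gives κ_s(K a) ≤ κ_t(a), κ_s(K a) is the meet of the κ_t(a) as soon as
-- each of its components that is 0 is attained: if K(a) ∈ s the successor above contains a,
-- and if K(a)′ ∉ s the successor generated with a′ added omits a′. Finally R_G = (R_H)⁻¹
-- turns the statement for Ĝ over R_H into the one for Ĥ over R_G.
module Submission where

open import Defs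
open import Level using (0ℓ)
open import Function using (flip; _∘_; id)
open import Data.Product using (_×_; ∃; _,_; proj₁; proj₂)
open import Data.Maybe using (just)
open import Relation.Binary.PropositionalEquality
  using (_≡_; _≢_; refl; sym; trans; cong; cong₂; subst; subst₂)
open import Function.Bundles using (_⇔_; mk⇔; Equivalence)
open import Axiom.ExcludedMiddle using (ExcludedMiddle)

open import Data.Bool using (Bool; true; false; not) renaming (_≤_ to _≤ᵇ_)
open import Data.Bool.Properties using (not-involutive; not-injective; not-¬; ¬-not)
  renaming (≤-minimum to ≤ᵇ-minimum; ≤-maximum to ≤ᵇ-maximum; ≤-refl to ≤ᵇ-refl)
open import Data.Sum using (inj₁; inj₂)
open import Function.Properties.Equivalence using () renaming (sym to ⇔-sym)
open import Relation.Binary.Structures using (IsPartialOrder)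
open import Relation.Nullary using (¬_; does; Dec; yes; no)
open import Relation.Nullary.Decidable using (dec-true; dec-false; does-⇔; decidable-stable)
open import Relation.Unary using (_⊆_; _∪_; ｛_｝)

not-≤ᵇ : ∀ {a b} → (b ≡ true → a ≡ true) → not a ≤ᵇ not b
not-≤ᵇ {b = false} _ = ≤ᵇ-maximum _
not-≤ᵇ {b = true}  f rewrite f refl = ≤ᵇ-refl

not-not-≤ᵇ : ∀ {a b} → (a ≡ true → b ≡ true) → not (not a) ≤ᵇ not (not b)
not-not-≤ᵇ {false} _ = ≤ᵇ-minimum _
not-not-≤ᵇ {true}  f rewrite f refl = ≤ᵇ-refl

≤ᵇ-true : ∀ {a b} → a ≤ᵇ b → a ≡ true → b ≡ true
≤ᵇ-true {b = true} _ _ = refl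
≤ᵇ-true {true} {false} () _

does≡true⇒ : ∀ {A : Set} (a? : Dec A) → does a? ≡ true → A
does≡true⇒ (yes a) _  = a
does≡true⇒ (no _)  ()

module _ (lem : ExcludedMiddle 0ℓ) {I : Set} {S : I → Set} where

  attained-lower-bound≡⋀M : (m : M₂) (p : I → M₂) → (∀ t → S t → m ≤M p t)
    → (proj₁ m ≡ false → ∃ λ t → S t × proj₁ (p t) ≡ false)
    → (proj₂ m ≡ false → ∃ λ t → S t × proj₂ (p t) ≡ false)
    → m ≡ ⋀M lem S p
  attained-lower-bound≡⋀M (b₁ , b₂) p lower attained₁ attained₂ =
    cong₂ _,_ (attained-lower-bound≡does (proj₁ ∘ p) (λ t → proj₁ ∘ lower t) attained₁)
              (attained-lower-bound≡does (proj₂ ∘ p) (λ t → proj₂ ∘ lower t) attained₂)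
    where
    attained-lower-bound≡does : ∀ {b} (f : I → Bool) → (∀ t → S t → b ≤ᵇ f t)
      → (b ≡ false → ∃ λ t → S t × f t ≡ false)
      → b ≡ does (lem {∀ t → S t → f t ≡ true})
    attained-lower-bound≡does {true} f lower _ =
      sym (dec-true lem (λ t St → ≤ᵇ-true (lower t St) refl))
    attained-lower-bound≡does {false} f _ attained with attained refl
    ... | t , St , ft≡false = sym (dec-false lem (λ all → not-¬ (all t St) ft≡false))

  ⋀M-cong : ∀ {S′ : I → Set} → (∀ t → S t ⇔ S′ t) → (p : I → M₂) → ⋀M lem S p ≡ ⋀M lem S′ p
  ⋀M-cong {S′} S⇔S′ p = cong₂ _,_ (does-⇔ (restrict proj₁) lem lem) (does-⇔ (restrict proj₂) lem lem)
    where
    restrict : (π : M₂ → Bool) → (∀ t → S t → π (p t) ≡ true) ⇔ (∀ t → S′ t → π (p t) ≡ true)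
    restrict π = mk⇔ (λ all t → all t ∘ Equivalence.from (S⇔S′ t))
                     (λ all t → all t ∘ Equivalence.to (S⇔S′ t))

module _ (𝔸 : DeMorganPoset) where
  open DeMorganPoset 𝔸
  open IsPartialOrder isPartialOrder using (antisym) renaming (refl to ≤-refl; trans to ≤-trans)
  open ProperDownSet

  𝟙′≡𝟘 : 𝟙 ′ ≡ 𝟘
  𝟙′≡𝟘 = antisym (subst (𝟙 ′ ≤_) (′-involutive 𝟘) (′-antitone (𝟙-greatest (𝟘 ′)))) (𝟘-least _)

  𝟘′≡𝟙 : 𝟘 ′ ≡ 𝟙
  𝟘′≡𝟙 = trans (cong _′ (sym 𝟙′≡𝟘)) (′-involutive 𝟙)

  ′-reflects-≤ : ∀ {a b} → a ′ ≤ b ′ → b ≤ a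
  ′-reflects-≤ {a} {b} a′≤b′ = subst₂ _≤_ (′-involutive b) (′-involutive a) (′-antitone a′≤b′)

  infix 4 _∈_ _∉_
  _∈_ _∉_ : Carrier → T 𝔸 → Set
  a ∈ D = member D a ≡ true
  a ∉ D = member D a ≡ false

  κ-≤M : ∀ {s t x y} → (x ∈ t → y ∈ s) → (y ′ ∈ s → x ′ ∈ t) → κ 𝔸 s y ≤M κ 𝔸 t x
  κ-≤M x∈t⇒y∈s y′∈s⇒x′∈t = not-≤ᵇ x∈t⇒y∈s , not-not-≤ᵇ y′∈s⇒x′∈t

  κ-monotone : ∀ {a b} → a ≤ b → ∀ s → κ 𝔸 s a ≤M κ 𝔸 s b
  κ-monotone a≤b s = κ-≤M {s} {s} (downClosed s a≤b) (downClosed s (′-antitone a≤b))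

  κ-′ : ∀ a s → κ 𝔸 s (a ′) ≡ negM (κ 𝔸 s a)
  κ-′ a s = cong₂ _,_ (sym (not-involutive _)) (cong (not ∘ not ∘ member s) (′-involutive a))

  κ-𝟘 : ∀ s → κ 𝔸 s 𝟘 ≡ 0M
  κ-𝟘 s = cong₂ _,_ (cong not (has𝟘 s)) (cong (not ∘ not) (trans (cong (member s) 𝟘′≡𝟙) (no𝟙 s)))

  κ-𝟙 : ∀ s → κ 𝔸 s 𝟙 ≡ 1M
  κ-𝟙 s = cong₂ _,_ (cong not (no𝟙 s)) (cong (not ∘ not) (trans (cong (member s) 𝟙′≡𝟘) (has𝟘 s)))

  iA-isDMPMorphism : IsDMPMorphism 𝔸 (iA 𝔸)
  iA-isDMPMorphism = (λ a b a≤b → κ-monotone a≤b) , κ-′ , κ-𝟘 , κ-𝟙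

  record IsSemiTenseOperator (K : PMap 𝔸) : Set where
    field
      K-𝟙 : K 𝟙 ≡ just 𝟙
      K-mono : ∀ {x y u v} → x ≤ y → K x ≡ just u → K y ≡ just v → u ≤ v
      K-dual : ∀ {x y u v} → x ≤ y → K (y ′) ≡ just v → K x ≡ just u → u ≤ v ′

  module _ {G H : PMap 𝔸} (st : SemiTense 𝔸 G H) where
    open SemiTense st

    G-isSemiTenseOperator : IsSemiTenseOperator G
    G-isSemiTenseOperator = record { K-𝟙 = G𝟙 ; K-mono = G-mono ; K-dual = GF }

    H-isSemiTenseOperator : IsSemiTenseOperator H
    H-isSemiTenseOperator = record { K-𝟙 = H𝟙 ; K-mono = H-mono ; K-dual = HP }

  module _ (lem : ExcludedMiddle 0ℓ) where

    Avoids : (Carrier → Set) → Carrier → Set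
    Avoids V z = ∀ {x} → V x → ¬ x ≤ z

    avoiding : (V : Carrier → Set) → Avoids V 𝟘 → ∃ V → T 𝔸
    avoiding V V≰𝟘 (c , Vc) = record
      { member = λ z → does (lem {Avoids V z})
      ; downClosed = λ a≤b b∈ → dec-true lem (λ Vx x≤a → does≡true⇒ lem b∈ Vx (≤-trans x≤a a≤b))
      ; has𝟘 = dec-true lem V≰𝟘
      ; no𝟙 = dec-false lem (λ avoids𝟙 → avoids𝟙 Vc (𝟙-greatest c))
      }

    module _ {V : Carrier → Set} (V≰𝟘 : Avoids V 𝟘) (V-inhabited : ∃ V) where

      ∈-avoiding : ∀ {z} → Avoids V z → z ∈ avoiding V V≰𝟘 V-inhabited
      ∈-avoiding = dec-true lem

      ∉-avoiding : ∀ {x z} → V x → x ≤ z → z ∉ avoiding V V≰𝟘 V-inhabited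
      ∉-avoiding Vx x≤z = dec-false lem (λ avoids → avoids Vx x≤z)

    ≰⇒κ-separates : ∀ {a b} → ¬ a ≤ b → ∃ λ t → ¬ (κ 𝔸 t a ≤M κ 𝔸 t b)
    ≰⇒κ-separates {a} {b} a≰b =
      t , λ κa≤κb → not-¬ (cong not b∈t) (≤ᵇ-true (proj₁ κa≤κb) (cong not a∉t))
      where
      a≰𝟘 : Avoids ｛ a ｝ 𝟘
      a≰𝟘 refl a≤𝟘 = a≰b (≤-trans a≤𝟘 (𝟘-least b))
      t : T 𝔸
      t = avoiding ｛ a ｝ a≰𝟘 (a , refl)
      a∉t : a ∉ t
      a∉t = ∉-avoiding a≰𝟘 (a , refl) refl ≤-refl
      b∈t : b ∈ t
      b∈t = ∈-avoiding a≰𝟘 (a , refl) λ { refl → a≰b }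

    𝟘≢𝟙⇒T-inhabited : 𝟘 ≢ 𝟙 → T 𝔸
    𝟘≢𝟙⇒T-inhabited 𝟘≢𝟙 = avoiding ｛ 𝟙 ｝ 𝟙≰𝟘 (𝟙 , refl)
      where
      𝟙≰𝟘 : Avoids ｛ 𝟙 ｝ 𝟘
      𝟙≰𝟘 refl 𝟙≤𝟘 = 𝟘≢𝟙 (antisym (𝟘-least 𝟙) 𝟙≤𝟘)

    iA-isOrderReflecting : IsOrderReflecting 𝔸 (iA 𝔸)
    iA-isOrderReflecting a b κa≤κb = decidable-stable lem λ a≰b →
      let t , κa≰κb = ≰⇒κ-separates a≰b in κa≰κb (κa≤κb t)

    module Successors {K : PMap 𝔸} (K-op : IsSemiTenseOperator K) where
      open IsSemiTenseOperator K-op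

      module _ (s : T 𝔸) where

        Escaping : Carrier → Set
        Escaping x = ∃ λ y → K x ≡ just y × y ∉ s

        Compatible : (Carrier → Set) → Set
        Compatible V = ∀ {x y z} → K x ≡ just y → y ′ ∈ s → V z → ¬ z ≤ x ′

        escaping-compatible : Compatible Escaping
        escaping-compatible {x} {y} Kx≡y y′∈s (w , Kz≡w , w∉s) z≤x′ =
          not-¬ (downClosed s (K-dual z≤x′ Kx′′≡y Kz≡w) y′∈s) w∉s
          where
          Kx′′≡y : K (x ′ ′) ≡ just y
          Kx′′≡y = subst (λ q → K q ≡ just y) (sym (′-involutive x)) Kx≡y

        module Successor {V : Carrier → Set} (V-escaping : Escaping ⊆ V) (V-compatible : Compatible V) where

          -- Compatibility at x = 𝟙 says that no generator lies below 𝟙 ′ = 𝟘.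
          V≰𝟘 : Avoids V 𝟘
          V≰𝟘 Vz z≤𝟘 =
            V-compatible K-𝟙 (subst (_∈ s) (sym 𝟙′≡𝟘) (has𝟘 s)) Vz (subst (_ ≤_) (sym 𝟙′≡𝟘) z≤𝟘)

          V-inhabited : ∃ V
          V-inhabited = 𝟙 , V-escaping (𝟙 , K-𝟙 , no𝟙 s)

          successor : T 𝔸
          successor = avoiding V V≰𝟘 V-inhabited

          ∈-successor : ∀ {z} → Avoids V z → z ∈ successor
          ∈-successor = ∈-avoiding V≰𝟘 V-inhabited

          ∉-successor : ∀ {x z} → V x → x ≤ z → z ∉ successor
          ∉-successor = ∉-avoiding V≰𝟘 V-inhabited

          successor-related : Rel 𝔸 K s successor
          successor-related x y Kx≡y =
            κ-≤M {s} {successor} x∈t⇒y∈s (λ y′∈s → ∈-successor (V-compatible Kx≡y y′∈s))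
            where
            x∈t⇒y∈s : x ∈ successor → y ∈ s
            x∈t⇒y∈s x∈t = ¬-not λ y∉s → not-¬ x∈t (∉-successor (V-escaping (y , Kx≡y , y∉s)) ≤-refl)

        module _ {a u} (Ka≡u : K a ≡ just u) where

          attained-at-h : h 𝔸 s u ≡ false → ∃ λ t → Rel 𝔸 K s t × h 𝔸 t a ≡ false
          attained-at-h hsu≡false = successor , successor-related , cong not (∈-successor a-avoids)
            where
            open Successor id escaping-compatible
            u∈s : u ∈ s
            u∈s = not-injective hsu≡false
            a-avoids : Avoids Escaping a
            a-avoids (w , Kz≡w , w∉s) z≤a = not-¬ (downClosed s (K-mono z≤a Kz≡w Ka≡u) u∈s) w∉s

          attained-at-h∂ : h∂ 𝔸 s u ≡ false → ∃ λ t → Rel 𝔸 K s t × h∂ 𝔸 t a ≡ false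
          attained-at-h∂ h∂su≡false =
            successor , successor-related , cong (not ∘ not) (∉-successor (inj₂ refl) ≤-refl)
            where
            u′∉s : u ′ ∉ s
            u′∉s = trans (sym (not-involutive _)) h∂su≡false
            compatible : Compatible (Escaping ∪ ｛ a ′ ｝)
            compatible Kx≡y y′∈s (inj₁ z-escaping) = escaping-compatible Kx≡y y′∈s z-escaping
            compatible Kx≡y y′∈s (inj₂ refl) a′≤x′ =
              not-¬ (downClosed s (′-antitone (K-mono (′-reflects-≤ a′≤x′) Kx≡y Ka≡u)) y′∈s) u′∉s
            open Successor inj₁ compatible

          κ-K≡⋀M : κ 𝔸 s u ≡ ⋀M lem (Rel 𝔸 K s) (λ t → κ 𝔸 t a)
          κ-K≡⋀M = attained-lower-bound≡⋀M lem (κ 𝔸 s u) (iA 𝔸 a) (λ t sRt → sRt a u Ka≡u)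
                     attained-at-h attained-at-h∂

      Rel-serial : Serial 𝔸 (Rel 𝔸 K)
      Rel-serial s = successor , successor-related
        where open Successor s id (escaping-compatible s)

      iA-K≡Ĝ : ∀ a u → K a ≡ just u → ∀ s → iA 𝔸 u s ≡ Ĝ 𝔸 lem (Rel 𝔸 K) (iA 𝔸 a) s
      iA-K≡Ĝ a u Ka≡u s = κ-K≡⋀M s Ka≡u

mainTheorem3 : (lem : ExcludedMiddle 0ℓ) (𝔸 : DeMorganPoset)
    → DeMorganPoset.𝟘 𝔸 ≢ DeMorganPoset.𝟙 𝔸
    → (G H : PMap 𝔸) → SemiTense 𝔸 G H
    → (∀ s t → Rel 𝔸 G s t ⇔ Rel 𝔸 H t s)
    → T 𝔸
      × Serial 𝔸 (Rel 𝔸 G)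
      × Serial 𝔸 (flip (Rel 𝔸 G))
      × IsDMPMorphism 𝔸 (iA 𝔸)
      × IsOrderReflecting 𝔸 (iA 𝔸)
      × (∀ a ga → G a ≡ just ga → ∀ s → iA 𝔸 ga s ≡ Ĝ 𝔸 lem (Rel 𝔸 G) (iA 𝔸 a) s)
      × (∀ a ha → H a ≡ just ha → ∀ s → iA 𝔸 ha s ≡ Ĥ 𝔸 lem (Rel 𝔸 G) (iA 𝔸 a) s)
mainTheorem3 lem 𝔸 𝟘≢𝟙 G H semiTense RG⇔RH⁻¹ =
    𝟘≢𝟙⇒T-inhabited 𝔸 lem 𝟘≢𝟙
  , OnG.Rel-serial
  , (λ s → let t , sRHt = OnH.Rel-serial s in t , Equivalence.from (RG⇔RH⁻¹ t s) sRHt)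
  , iA-isDMPMorphism 𝔸
  , iA-isOrderReflecting 𝔸 lem
  , OnG.iA-K≡Ĝ
  , (λ a u Ha≡u s → trans (OnH.iA-K≡Ĝ a u Ha≡u s)
                          (⋀M-cong lem (λ t → ⇔-sym (RG⇔RH⁻¹ t s)) (iA 𝔸 a)))
  where
  module OnG = Successors 𝔸 lem (G-isSemiTenseOperator 𝔸 semiTense)
  module OnH = Successors 𝔸 lem (H-isSemiTenseOperator 𝔸 semiTense)
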